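{- Suppose that there exist three 4-GDDs of type $g_{1}g_{2}\ldots g_{s}$ (on the same point set with the same groups) which intersect in exactly $b$ blocks. Suppose that for each $1\leq i\leq s$ there exist three $S(2,4,g_{i}+4)$ designs with exactly $b_{i}$ common blocks, all of which contain a common block $y$. Then there exist three $S(2,4,\sum_{i=1}^{s}g_{i}+4)$ designs with exactly $b+\sum_{i=1}^{s}b_{i}-(s-1)$ common blocks.
   Context: An $S(2,4,v)$ design is a pair $(\mathcal{V},\mathcal{B})$ with $|\mathcal{V}|=v$ and $\mathcal{B}$ a family of 4-subsets (blocks) of $\mathcal{V}$ such that each 2-subset of $\mathcal{V}$ lies in exactly one block. A 4-GDD of type $g_1g_2\cdots g_s$ is a triple $(\mathcal{X},\mathcal{G},\mathcal{A})$ where $\mathcal{G}=\{G_1,\dots,G_s\}$ is a partition of the finite set $\mathcal{X}$ into groups with $|G_i|=g_i$, $\mathcal{A}$ is a set of 4-subsets of $\mathcal{X}$ (blocks), each block meets each group in at most one element, and every pair of elements from distinct groups lies in exactly one block. Three designs (or three GDDs on the same points with the same groups) with block sets $\mathcal{B}_1,\mathcal{B}_2,\mathcal{B}_3$ have (intersect in) exactly $b$ common blocks if $\mathcal{B}_1\cap\mathcal{B}_2=\mathcal{B}_1\cap\mathcal{B}_3=\mathcal{B}_2\cap\mathcal{B}_3$ and this set has exactly $b$ blocks. -}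

module Defs where

open import Data.Nat using (ℕ)
open import Data.Bool using (Bool) renaming (_≟_ to _≟ᴮ_)
open import Data.Fin using (Fin) renaming (_≟_ to _≟ᶠ_)
open import Data.Fin.Subset using (Subset; _∈_; ∣_∣)
open import Data.Fin.Subset.Properties using (_∈?_)
open import Data.Vec as Vec using (allFin)
open import Data.Vec.Properties using (≡-dec)
open import Data.List using (List; length; filter)
open import Data.List.Relation.Unary.Any using (any?)
open import Data.List.Membership.Propositional renaming (_∈_ to _∈ᴸ_)
open import Data.Product using (_×_)
open import Relation.Nullary using (¬_; Dec)
open import Relation.Nullary.Decidable using (_×-dec_)
open import Relation.Binary.PropositionalEquality using (_≡_; _≢_)
open import Function.Bundles using (_⇔_)

Block : ℕ → Set
Block v = Subset v

Blocks : ℕ → Set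
Blocks v = List (Block v)

_∈ᴮ?_ : ∀ {v} (B : Block v) (ℬ : Blocks v) → Dec (B ∈ᴸ ℬ)
B ∈ᴮ? ℬ = any? (λ C → ≡-dec _≟ᴮ_ B C) ℬ

pairCount : ∀ {v} → Fin v → Fin v → Blocks v → ℕ
pairCount x y ℬ = length (filter (λ B → (x ∈? B) ×-dec (y ∈? B)) ℬ)

record IsS24 (v : ℕ) (ℬ : Blocks v) : Set where
  field
    blockSize : ∀ B → B ∈ᴸ ℬ → ∣ B ∣ ≡ 4
    pairOnce  : ∀ (x y : Fin v) → x ≢ y → pairCount x y ℬ ≡ 1

-- group assignment grp : Fin n → Fin s has type g₁…gₛ, i.e. |G_i| = g i
HasType : ∀ {n s} → (Fin n → Fin s) → (Fin s → ℕ) → Set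
HasType {n} {s} grp g = ∀ (i : Fin s) → Vec.count (λ x → grp x ≟ᶠ i) (allFin n) ≡ g i

-- (Fin n, groups given by grp, ℬ) is a 4-GDD (the type is imposed separately by HasType)
record IsGDD4 {n s : ℕ} (grp : Fin n → Fin s) (ℬ : Blocks n) : Set where
  field
    blockSize  : ∀ B → B ∈ᴸ ℬ → ∣ B ∣ ≡ 4
    transverse : ∀ B → B ∈ᴸ ℬ → ∀ (x y : Fin n) → x ∈ B → y ∈ B → grp x ≡ grp y → x ≡ y
    pairOnce   : ∀ (x y : Fin n) → grp x ≢ grp y → pairCount x y ℬ ≡ 1

ExactlyCommon : ∀ {v} → Blocks v → Blocks v → Blocks v → ℕ → Set
ExactlyCommon ℬ₁ ℬ₂ ℬ₃ b =
  (∀ B → ((B ∈ᴸ ℬ₁) × (B ∈ᴸ ℬ₂)) ⇔ ((B ∈ᴸ ℬ₁) × (B ∈ᴸ ℬ₃))) ×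
  (∀ B → ((B ∈ᴸ ℬ₁) × (B ∈ᴸ ℬ₂)) ⇔ ((B ∈ᴸ ℬ₂) × (B ∈ᴸ ℬ₃))) ×
  (length (filter (λ B → B ∈ᴮ? ℬ₂) ℬ₁) ≡ b)

-- Adjoin four new points ∞ to the points of the GDD and place the i-th ingredient design on
-- Gᵢ ∪ ∞, its shared block y going onto ∞. The GDD blocks, the ingredient blocks other than y
-- and the single block ∞ form an S(2,4,Σgᵢ+4): a pair from distinct groups is covered by the GDD
-- alone, a pair inside Gᵢ ∪ ∞ by the i-th ingredient alone, except that pairs inside ∞ are now
-- covered by the block ∞ instead of by y. A block of the new design remembers its origin (GDD
-- blocks avoid ∞ and meet each group at most once, an ingredient block other than y lies in
-- Gᵢ ∪ ∞ and meets Gᵢ), so two new designs share exactly ∞ and the images of the blocks shared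
-- by their GDDs and by their ingredients other than y: b + Σ(bᵢ − 1) + 1 blocks.

module Submission where

open import Defs
open import Data.Nat using (ℕ; zero; suc; pred; _+_; _≤_; _∸_)
open import Data.Nat.Tactic.RingSolver using (solve-∀)
open import Data.Nat.Properties using (≤-antisym; +-assoc; +-suc; m+n≡0⇒m≡0; m+n≡0⇒n≡0; +-identityʳ; m+n∸n≡m)
open import Data.Fin using (Fin; zero; suc; cast; toℕ; _↑ˡ_; _↑ʳ_; splitAt) renaming (_≟_ to _≟ᶠ_)
open import Data.Fin.Properties using (toℕ-cast; toℕ-injective; suc-injective; injective⇒≤; any?; cast-involutive;
  ↑ˡ-injective; ↑ʳ-injective; splitAt-↑ˡ; splitAt-↑ʳ; splitAt⁻¹-↑ˡ; splitAt⁻¹-↑ʳ)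
open import Data.Fin.Subset using (Subset; _∈_; _∉_; ∣_∣; inside; outside; ∁; ⊤)
open import Data.Fin.Subset.Properties using (_∈?_; ∈⊤; ∣⊤∣≡n; ∣∁p∣≡n∸∣p∣; ⊆-antisym; x∉p⇒x∈∁p; x∈∁p⇒x∉p)
open import Data.Vec using (Vec; []; _∷_; here; there; sum; tabulate; count; allFin)
open import Data.Vec.Properties using (≡-dec; tabulate-cong; lookup∘tabulate; lookup⇒[]=; []=⇒lookup)
open import Data.Bool using (Bool; true; false; if_then_else_) renaming (_≟_ to _≟ᵇ_)
open import Data.Product using (Σ; _×_; ∃; ∃₂; _,_; proj₁; proj₂; swap)
open import Data.Sum using (_⊎_; inj₁; inj₂)
open import Relation.Nullary using (¬_; ¬?; Dec; yes; no; does; contradiction)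
open import Relation.Nullary.Decidable using (_×-dec_; dec-true)
open import Level using (0ℓ)
open import Relation.Unary using (Pred; Decidable)
open import Data.List as List using (List; []; _∷_; _++_; map; filter; length; concat)
open import Data.List.Properties using (filter-≐; filter-++; length-++; filter-all; filter-none; filter-some)
open import Data.List.Relation.Unary.All as All using ()
open import Data.List.Relation.Unary.Any as Any using ()
open import Data.List.Membership.Propositional using (lose) renaming (_∈_ to _∈ᴸ_)
open import Data.List.Membership.Propositional.Properties
  using (∈-map⁺; ∈-map⁻; ∈-++⁺ˡ; ∈-++⁺ʳ; ∈-++⁻; ∈-concat⁺′; ∈-concat⁻′; ∈-filter⁺; ∈-filter⁻)
  renaming (∈-tabulate⁺ to ∈ᴸ-tabulate⁺; ∈-tabulate⁻ to ∈ᴸ-tabulate⁻)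
open import Relation.Binary.PropositionalEquality using (_≡_; _≢_; refl; sym; trans; cong; cong₂; subst; module ≡-Reasoning)
open import Relation.Binary.Definitions using (DecidableEquality)
open import Function using (_∘_; id)
open import Function.Bundles using (Equivalence; _⇔_; mk⇔)
open import Function.Definitions using (Injective)

private variable k m : ℕ

index : {p : Subset k} {x : Fin k} → x ∈ p → Fin ∣ p ∣
index {p = inside ∷ p} here = zero
index {p = inside ∷ p} (there x∈p) = suc (index x∈p)
index {p = outside ∷ p} (there x∈p) = index x∈p

element : (p : Subset k) → Fin ∣ p ∣ → Fin k
element (inside ∷ p) zero = zero
element (inside ∷ p) (suc j) = suc (element p j)
element (outside ∷ p) j = suc (element p j)

element∈ : (p : Subset k) (j : Fin ∣ p ∣) → element p j ∈ p
element∈ (inside ∷ p) zero = here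
element∈ (inside ∷ p) (suc j) = there (element∈ p j)
element∈ (outside ∷ p) j = there (element∈ p j)

index-element : (p : Subset k) (j : Fin ∣ p ∣) (e∈p : element p j ∈ p) → index e∈p ≡ j
index-element (inside ∷ p) zero here = refl
index-element (inside ∷ p) (suc j) (there e∈p) = cong suc (index-element p j e∈p)
index-element (outside ∷ p) j (there e∈p) = index-element p j e∈p

element-index : {p : Subset k} {x : Fin k} (x∈p : x ∈ p) → element p (index x∈p) ≡ x
element-index {p = inside ∷ p} here = refl
element-index {p = inside ∷ p} (there x∈p) = cong suc (element-index x∈p)
element-index {p = outside ∷ p} (there x∈p) = cong suc (element-index x∈p)

index-injective : {p : Subset k} {x y : Fin k} (x∈p : x ∈ p) (y∈p : y ∈ p) → index x∈p ≡ index y∈p → x ≡ y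
index-injective x∈p y∈p eq = trans (sym (element-index x∈p)) (trans (cong (element _) eq) (element-index y∈p))

element-injective : (p : Subset k) {i j : Fin ∣ p ∣} → element p i ≡ element p j → i ≡ j
element-injective (inside ∷ p) {zero} {zero} eq = refl
element-injective (inside ∷ p) {suc i} {suc j} eq = cong suc (element-injective p (suc-injective eq))
element-injective (outside ∷ p) eq = element-injective p (suc-injective eq)

injection⇒∣p∣≤∣q∣ : {p : Subset k} {q : Subset m} (h : ∀ {x} → x ∈ p → Fin m) →
  (∀ {x} (x∈p : x ∈ p) → h x∈p ∈ q) →
  (∀ {x y} (x∈p : x ∈ p) (y∈p : y ∈ p) → h x∈p ≡ h y∈p → x ≡ y) → ∣ p ∣ ≤ ∣ q ∣
injection⇒∣p∣≤∣q∣ {p = p} h h∈q h-injective = injective⇒≤ injective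
  where
  f : Fin ∣ p ∣ → Fin _
  f j = index (h∈q (element∈ p j))
  injective : ∀ {i j} → f i ≡ f j → i ≡ j
  injective {i} {j} eq =
    element-injective p (h-injective _ _ (index-injective (h∈q (element∈ p i)) (h∈q (element∈ p j)) eq))

∈-tabulate⁺ : {h : Fin k → Bool} {x : Fin k} → h x ≡ true → x ∈ tabulate h
∈-tabulate⁺ {x = x} hx = lookup⇒[]= x _ (trans (lookup∘tabulate _ x) hx)

∈-tabulate⁻ : {h : Fin k → Bool} {x : Fin k} → x ∈ tabulate h → h x ≡ true
∈-tabulate⁻ {x = x} x∈ = trans (sym (lookup∘tabulate _ x)) ([]=⇒lookup x∈)

image : (Fin k → Fin m) → Subset k → Subset m
image f B = tabulate λ u → does (any? λ x → x ∈? B ×-dec f x ≟ᶠ u)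

∈-image⁺ : (f : Fin k → Fin m) {B : Subset k} {x : Fin k} → x ∈ B → f x ∈ image f B
∈-image⁺ f {B} {x} x∈B = ∈-tabulate⁺ (dec-true (any? λ y → y ∈? B ×-dec f y ≟ᶠ f x) (x , x∈B , refl))

∈-image⁻ : (f : Fin k → Fin m) {B : Subset k} {u : Fin m} → u ∈ image f B → ∃ λ x → x ∈ B × f x ≡ u
∈-image⁻ f {B} {u} u∈ with any? (λ x → x ∈? B ×-dec f x ≟ᶠ u) | ∈-tabulate⁻ u∈
... | yes witness | _ = witness

∣image∣ : {f : Fin k → Fin m} → Injective _≡_ _≡_ f → (B : Subset k) → ∣ image f B ∣ ≡ ∣ B ∣
∣image∣ {f = f} f-injective B = ≤-antisym
  (injection⇒∣p∣≤∣q∣ (proj₁ ∘ ∈-image⁻ f) (proj₁ ∘ proj₂ ∘ ∈-image⁻ f) preimage-injective)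
  (injection⇒∣p∣≤∣q∣ (λ {x} _ → f x) (∈-image⁺ f) (λ _ _ → f-injective))
  where
  preimage-injective : ∀ {u v} (u∈ : u ∈ image f B) (v∈ : v ∈ image f B) →
    proj₁ (∈-image⁻ f u∈) ≡ proj₁ (∈-image⁻ f v∈) → u ≡ v
  preimage-injective u∈ v∈ eq with ∈-image⁻ f u∈ | ∈-image⁻ f v∈
  ... | _ , _ , refl | _ , _ , refl = cong f eq

image-injective : {f : Fin k → Fin m} → Injective _≡_ _≡_ f → Injective _≡_ _≡_ (image f)
image-injective {f = f} f-injective {A} {B} eq = ⊆-antisym (transport eq) (transport (sym eq))
  where
  transport : ∀ {A B} → image f A ≡ image f B → ∀ {x} → x ∈ A → x ∈ B
  transport {B = B} eq x∈A with ∈-image⁻ f (subst (_ ∈_) eq (∈-image⁺ f x∈A))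
  ... | x′ , x′∈B , fx′≡fx = subst (_∈ B) (f-injective fx′≡fx) x′∈B

cast-injective : ∀ .(eq : k ≡ m) {i j : Fin k} → cast eq i ≡ cast eq j → i ≡ j
cast-injective eq {i} {j} e = toℕ-injective (trans (sym (toℕ-cast eq i)) (trans (cong toℕ e) (toℕ-cast eq j)))

two-members : (C : Subset k) → ∣ C ∣ ≡ suc (suc m) → ∃₂ λ x y → x ≢ y × x ∈ C × y ∈ C
two-members C eq = element C i , element C j , i≢j ∘ element-injective C , element∈ C i , element∈ C j
  where
  i j : Fin ∣ C ∣
  i = cast (sym eq) zero
  j = cast (sym eq) (suc zero)
  i≢j : i ≢ j
  i≢j e with cast-injective (sym eq) e
  ... | ()

∣tabulate∣≡count : {A : Set} {P : Pred A 0ℓ} (P? : Decidable P) (f : Fin k → A) →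
  ∣ tabulate (does ∘ P? ∘ f) ∣ ≡ count P? (tabulate f)
∣tabulate∣≡count {k = zero} P? f = refl
∣tabulate∣≡count {k = suc k} P? f with does (P? (f zero))
... | true = cong suc (∣tabulate∣≡count P? (f ∘ suc))
... | false = ∣tabulate∣≡count P? (f ∘ suc)

sum-tabulate-≡0 : ∀ {s} {h : Fin s → ℕ} → (∀ i → h i ≡ 0) → sum (tabulate h) ≡ 0
sum-tabulate-≡0 {zero} h≡0 = refl
sum-tabulate-≡0 {suc s} h≡0 = cong₂ _+_ (h≡0 zero) (sum-tabulate-≡0 (h≡0 ∘ suc))

sum-tabulate-single : ∀ {s} {h : Fin s → ℕ} (j : Fin s) → (∀ i → i ≢ j → h i ≡ 0) → sum (tabulate h) ≡ h j
sum-tabulate-single {h = h} zero h≡0 =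
  trans (cong (h zero +_) (sum-tabulate-≡0 λ i → h≡0 (suc i) λ ())) (+-identityʳ (h zero))
sum-tabulate-single (suc j) h≡0 =
  cong₂ _+_ (h≡0 zero λ ()) (sum-tabulate-single j λ i i≢j → h≡0 (suc i) (i≢j ∘ suc-injective))

sum-of-fibre-counts : ∀ {s} {A : Set} (f : A → Fin s) (xs : Vec A m) →
  sum (tabulate λ i → count (λ x → f x ≟ᶠ i) xs) ≡ m
sum-of-fibre-counts {s = s} f [] = sum-tabulate-≡0 {s} λ _ → refl
sum-of-fibre-counts f (x ∷ xs) = trans (sum-bump (f x) _) (cong suc (sum-of-fibre-counts f xs))
  where
  sum-bump : ∀ {s} (j : Fin s) (c : Fin s → ℕ) →
    sum (tabulate λ i → (if does (j ≟ᶠ i) then suc else id) (c i)) ≡ suc (sum (tabulate c))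
  sum-bump zero c = refl
  sum-bump (suc j) c = trans (cong (c zero +_) (sum-bump j (c ∘ suc))) (+-suc (c zero) _)

sum-tabulate-suc : ∀ {s} (h : Fin s → ℕ) → sum (tabulate (suc ∘ h)) ≡ sum (tabulate h) + s
sum-tabulate-suc {zero} h = refl
sum-tabulate-suc {suc s} h = begin
  suc (h zero + sum (tabulate (suc ∘ h ∘ suc)))  ≡⟨ cong (λ a → suc (h zero + a)) (sum-tabulate-suc (h ∘ suc)) ⟩
  suc (h zero + (sum (tabulate (h ∘ suc)) + s))  ≡⟨ cong suc (+-assoc (h zero) _ s) ⟨
  suc (sum (tabulate h) + s)                     ≡⟨ +-suc _ s ⟨
  sum (tabulate h) + suc s                       ∎
  where open ≡-Reasoning

number-of-points : ∀ {n s} (grp : Fin n → Fin s) {g : Fin s → ℕ} → HasType grp g → sum (tabulate g) ≡ n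
number-of-points grp type = trans (cong sum (tabulate-cong (sym ∘ type))) (sum-of-fibre-counts grp (allFin _))

module _ {A : Set} {P : Pred A 0ℓ} (P? : Decidable P) where

  length-filter-++ : (xs ys : List A) → length (filter P? (xs ++ ys)) ≡ length (filter P? xs) + length (filter P? ys)
  length-filter-++ xs ys = trans (cong length (filter-++ P? xs ys)) (length-++ (filter P? xs))

  length-filter-none : (xs : List A) → (∀ {x} → x ∈ᴸ xs → ¬ P x) → length (filter P? xs) ≡ 0
  length-filter-none xs none = cong length (filter-none P? (All.tabulate none))

  length-filter-all : (xs : List A) → (∀ {x} → x ∈ᴸ xs → P x) → length (filter P? xs) ≡ length xs
  length-filter-all xs all = cong length (filter-all P? (All.tabulate all))

  1≤length-filter : {x : A} {xs : List A} → x ∈ᴸ xs → P x → 1 ≤ length (filter P? xs)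
  1≤length-filter x∈xs px = filter-some P? (lose x∈xs px)

  length-filter-split : {Q : Pred A 0ℓ} (Q? : Decidable Q) (xs : List A) → length (filter P? xs) ≡
    length (filter P? (filter Q? xs)) + length (filter P? (filter (¬? ∘ Q?) xs))
  length-filter-split Q? [] = refl
  length-filter-split Q? (x ∷ xs) with does (Q? x)
  ... | true with does (P? x)
  ...   | true = cong suc (length-filter-split Q? xs)
  ...   | false = length-filter-split Q? xs
  length-filter-split Q? (x ∷ xs) | false with does (P? x)
  ...   | true = trans (cong suc (length-filter-split Q? xs)) (sym (+-suc _ _))
  ...   | false = length-filter-split Q? xs

  length-filter-concat : ∀ {s} (F : Fin s → List A) →
    length (filter P? (concat (List.tabulate F))) ≡ sum (tabulate λ i → length (filter P? (F i)))
  length-filter-concat {zero} F = refl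
  length-filter-concat {suc s} F =
    trans (length-filter-++ (F zero) _) (cong (length (filter P? (F zero)) +_) (length-filter-concat (F ∘ suc)))

length-filter-map : {A B : Set} {P : Pred B 0ℓ} {Q : Pred A 0ℓ} (P? : Decidable P) (Q? : Decidable Q)
  (h : A → B) (xs : List A) → (∀ {x} → x ∈ᴸ xs → P (h x) → Q x) → (∀ {x} → x ∈ᴸ xs → Q x → P (h x)) →
  length (filter P? (map h xs)) ≡ length (filter Q? xs)
length-filter-map P? Q? h [] to from = refl
length-filter-map P? Q? h (x ∷ xs) to from with P? (h x) | Q? x
... | yes _ | yes _ = cong suc (length-filter-map P? Q? h xs (to ∘ Any.there) (from ∘ Any.there))
... | no _ | no _ = length-filter-map P? Q? h xs (to ∘ Any.there) (from ∘ Any.there)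
... | yes p | no ¬q = contradiction (to (Any.here refl) p) ¬q
... | no ¬p | yes q = contradiction (from (Any.here refl) q) ¬p

pairCount-sym : {x y : Fin k} (L : Blocks k) → pairCount x y L ≡ pairCount y x L
pairCount-sym L = cong length (filter-≐ _ _ (swap , swap) L)

pairCount-image : {f : Fin k → Fin m} → Injective _≡_ _≡_ f → {x y : Fin k} {u v : Fin m} →
  f x ≡ u → f y ≡ v → (L : Blocks k) → pairCount u v (map (image f) L) ≡ pairCount x y L
pairCount-image {f = f} f-injective refl refl L = length-filter-map _ _ (image f) L
  (λ _ (fx∈ , fy∈) → preimage fx∈ , preimage fy∈) (λ _ (x∈ , y∈) → ∈-image⁺ f x∈ , ∈-image⁺ f y∈)
  where
  preimage : ∀ {B x} → f x ∈ image f B → x ∈ B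
  preimage {B} fx∈ with ∈-image⁻ f fx∈
  ... | _ , x′∈B , fx′≡fx = subst (_∈ B) (f-injective fx′≡fx) x′∈B

pairCount-image-∉ˡ : {f : Fin k → Fin m} {u : Fin m} → (∀ x → f x ≢ u) → (v : Fin m) (L : Blocks k) →
  pairCount u v (map (image f) L) ≡ 0
pairCount-image-∉ˡ {f = f} u∉ v L = length-filter-none _ (map (image f) L) λ B∈ (u∈B , _) →
  let (_ , _ , B≡) = ∈-map⁻ (image f) B∈ in
  u∉ _ (proj₂ (proj₂ (∈-image⁻ f (subst (_ ∈_) B≡ u∈B))))

pairCount-image-∉ʳ : {f : Fin k → Fin m} {v : Fin m} → (∀ x → f x ≢ v) → (u : Fin m) (L : Blocks k) →
  pairCount u v (map (image f) L) ≡ 0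
pairCount-image-∉ʳ v∉ u L = trans (pairCount-sym (map (image _) L)) (pairCount-image-∉ˡ v∉ u L)

pairCount-⊤ : (x y : Fin k) → pairCount x y (⊤ ∷ []) ≡ 1
pairCount-⊤ x y = length-filter-all (λ B → x ∈? B ×-dec y ∈? B) (⊤ ∷ [])
  λ { (Any.here refl) → ∈⊤ , ∈⊤ }


ThreeDesigns : ℕ → (ℕ → Set) → Set
ThreeDesigns v P = Σ (Blocks v) λ ℬ₁ → Σ (Blocks v) λ ℬ₂ → Σ (Blocks v) λ ℬ₃ → Σ ℕ λ c →
  IsS24 v ℬ₁ × IsS24 v ℬ₂ × IsS24 v ℬ₃ × ExactlyCommon ℬ₁ ℬ₂ ℬ₃ c × P c

Common : {A : Set} → List A → List A → Pred A 0ℓ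
Common L L′ x = x ∈ᴸ L × x ∈ᴸ L′

Transversal : ∀ {n s} → (Fin n → Fin s) → Subset n → Set
Transversal grp A = ∀ {x y} → x ∈ A → y ∈ A → grp x ≡ grp y → x ≡ y

_≟ˢ_ : DecidableEquality (Subset k)
_≟ˢ_ = ≡-dec _≟ᵇ_

module Construction {s n : ℕ} (g : Fin s → ℕ) (grp : Fin n → Fin s) (type : HasType grp g)
  (y : ∀ i → Subset (g i + 4)) (∣y∣≡4 : ∀ i → ∣ y i ∣ ≡ 4) where

  open ≡-Reasoning

  old : Fin n → Fin (n + 4)
  old x = x ↑ˡ 4

  ∞ : Fin 4 → Fin (n + 4)
  ∞ e = n ↑ʳ e

  old-injective : Injective _≡_ _≡_ old
  old-injective = ↑ˡ-injective 4 _ _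

  ∞-injective : Injective _≡_ _≡_ ∞
  ∞-injective = ↑ʳ-injective n _ _

  old≢∞ : ∀ x e → old x ≢ ∞ e
  old≢∞ x e eq with trans (sym (splitAt-↑ˡ n x 4)) (trans (cong (splitAt n) eq) (splitAt-↑ʳ n 4 e))
  ... | ()

  old-or-∞ : ∀ u → (∃ λ x → old x ≡ u) ⊎ (∃ λ e → ∞ e ≡ u)
  old-or-∞ u with splitAt n u in eq
  ... | inj₁ x = inj₁ (x , splitAt⁻¹-↑ˡ eq)
  ... | inj₂ e = inj₂ (e , splitAt⁻¹-↑ʳ eq)

  fibre : Fin s → Subset n
  fibre i = tabulate λ x → does (grp x ≟ᶠ i)

  ∈-fibre⁺ : ∀ {x i} → grp x ≡ i → x ∈ fibre i
  ∈-fibre⁺ {x} {i} eq = ∈-tabulate⁺ (dec-true (grp x ≟ᶠ i) eq)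

  ∈-fibre⁻ : ∀ {x i} → x ∈ fibre i → grp x ≡ i
  ∈-fibre⁻ {x} {i} x∈ with grp x ≟ᶠ i | ∈-tabulate⁻ x∈
  ... | yes eq | _ = eq

  ∣fibre∣ : ∀ i → ∣ fibre i ∣ ≡ g i
  ∣fibre∣ i = trans (∣tabulate∣≡count (λ x → grp x ≟ᶠ i) id) (type i)

  ∣∁y∣ : ∀ i → ∣ ∁ (y i) ∣ ≡ ∣ fibre i ∣
  ∣∁y∣ i = begin
    ∣ ∁ (y i) ∣        ≡⟨ ∣∁p∣≡n∸∣p∣ (y i) ⟩
    g i + 4 ∸ ∣ y i ∣  ≡⟨ cong (g i + 4 ∸_) (∣y∣≡4 i) ⟩
    g i + 4 ∸ 4        ≡⟨ m+n∸n≡m (g i) 4 ⟩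
    g i                ≡⟨ ∣fibre∣ i ⟨
    ∣ fibre i ∣        ∎

  -- The i-th ingredient design is placed on Gᵢ ∪ ∞, where Gᵢ = fibre i: the points of y i go onto
  -- ∞ and the remaining gᵢ points onto Gᵢ, both in increasing order.
  relabel′ : ∀ i p → Dec (p ∈ y i) → Fin (n + 4)
  relabel′ i p (yes p∈y) = ∞ (cast (∣y∣≡4 i) (index p∈y))
  relabel′ i p (no p∉y) = old (element (fibre i) (cast (∣∁y∣ i) (index (x∉p⇒x∈∁p p∉y))))

  relabel : ∀ i → Fin (g i + 4) → Fin (n + 4)
  relabel i p = relabel′ i p (p ∈? y i)

  relabel-injective : ∀ i → Injective _≡_ _≡_ (relabel i)
  relabel-injective i {p} {q} = injective (p ∈? y i) (q ∈? y i)
    where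
    injective : (p? : Dec (p ∈ y i)) (q? : Dec (q ∈ y i)) → relabel′ i p p? ≡ relabel′ i q q? → p ≡ q
    injective (yes p∈y) (yes q∈y) eq = index-injective p∈y q∈y (cast-injective (∣y∣≡4 i) (∞-injective eq))
    injective (no p∉y) (no q∉y) eq =
      index-injective (x∉p⇒x∈∁p p∉y) (x∉p⇒x∈∁p q∉y)
        (cast-injective (∣∁y∣ i) (element-injective (fibre i) (old-injective eq)))
    injective (yes _) (no _) eq = contradiction (sym eq) (old≢∞ _ _)
    injective (no _) (yes _) eq = contradiction eq (old≢∞ _ _)

  relabel-∉y : ∀ i {p} → p ∉ y i → ∃ λ x → grp x ≡ i × relabel i p ≡ old x
  relabel-∉y i {p} p∉y with p ∈? y i
  ... | yes p∈y = contradiction p∈y p∉y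
  ... | no _ = _ , ∈-fibre⁻ (element∈ (fibre i) _) , refl

  relabel≡old⇒grp : ∀ i p {x} → relabel i p ≡ old x → grp x ≡ i
  relabel≡old⇒grp i p eq with p ∈? y i
  ... | yes _ = contradiction (sym eq) (old≢∞ _ _)
  ... | no _ = subst (λ x → grp x ≡ i) (old-injective eq) (∈-fibre⁻ (element∈ (fibre i) _))

  relabel-onto-∞ : ∀ i e → ∃ λ p → p ∈ y i × relabel i p ≡ ∞ e
  relabel-onto-∞ i e = p , element∈ (y i) j , relabel-p
    where
    j : Fin ∣ y i ∣
    j = cast (sym (∣y∣≡4 i)) e
    p : Fin (g i + 4)
    p = element (y i) j
    relabel-p : relabel i p ≡ ∞ e
    relabel-p with p ∈? y i
    ... | yes p∈y = cong ∞ (trans (cong (cast (∣y∣≡4 i)) (index-element (y i) j p∈y))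
                                  (cast-involutive (∣y∣≡4 i) _ e))
    ... | no p∉y = contradiction (element∈ (y i) j) p∉y

  relabel-onto-fibre : ∀ i {x} → grp x ≡ i → ∃ λ p → p ∉ y i × relabel i p ≡ old x
  relabel-onto-fibre i {x} grp-x≡i = p , p∉y , relabel-p
    where
    x∈ : x ∈ fibre i
    x∈ = ∈-fibre⁺ grp-x≡i
    j : Fin ∣ ∁ (y i) ∣
    j = cast (sym (∣∁y∣ i)) (index x∈)
    p : Fin (g i + 4)
    p = element (∁ (y i)) j
    p∉y : p ∉ y i
    p∉y = x∈∁p⇒x∉p (element∈ (∁ (y i)) j)
    relabel-p : relabel i p ≡ old x
    relabel-p with p ∈? y i
    ... | yes p∈y = contradiction p∈y p∉y
    ... | no p∉y′ = cong old (begin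
      element (fibre i) (cast (∣∁y∣ i) (index (x∉p⇒x∈∁p p∉y′)))
        ≡⟨ cong (element (fibre i) ∘ cast (∣∁y∣ i)) (index-element (∁ (y i)) j _) ⟩
      element (fibre i) (cast (∣∁y∣ i) j)
        ≡⟨ cong (element (fibre i)) (cast-involutive (∣∁y∣ i) _ (index x∈)) ⟩
      element (fibre i) (index x∈)
        ≡⟨ element-index x∈ ⟩
      x ∎)

  ∞-block : Subset (n + 4)
  ∞-block = image ∞ ⊤

  without-y : ∀ i → Blocks (g i + 4) → Blocks (g i + 4)
  without-y i = filter λ C → ¬? (C ≟ˢ y i)

  relabelled : ∀ i → Blocks (g i + 4) → Blocks (n + 4)
  relabelled i ℬᵢ = map (image (relabel i)) (without-y i ℬᵢ)

  build : Blocks n → (∀ i → Blocks (g i + 4)) → Blocks (n + 4)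
  build 𝒜 ℬ = map (image old) 𝒜 ++ (concat (List.tabulate λ i → relabelled i (ℬ i)) ++ ∞-block ∷ [])

  pairCount-build : ∀ u v 𝒜 ℬ → pairCount u v (build 𝒜 ℬ) ≡
    pairCount u v (map (image old) 𝒜) +
    (sum (tabulate λ i → pairCount u v (relabelled i (ℬ i))) + pairCount u v (∞-block ∷ []))
  pairCount-build u v 𝒜 ℬ = trans (length-filter-++ _ (map (image old) 𝒜) _)
    (cong (pairCount u v (map (image old) 𝒜) +_)
      (trans (length-filter-++ _ (concat (List.tabulate λ i → relabelled i (ℬ i))) _)
        (cong (_+ pairCount u v (∞-block ∷ [])) (length-filter-concat _ λ i → relabelled i (ℬ i)))))

  ∞-block≢old-block : ∀ A → ∞-block ≢ image old A
  ∞-block≢old-block A eq with ∈-image⁻ old (subst (∞ zero ∈_) eq (∈-image⁺ ∞ {⊤} ∈⊤))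
  ... | x , _ , old-x≡∞ = old≢∞ x zero old-x≡∞

  ∞-block≢relabel-block : ∀ i {C p} → p ∈ C → p ∉ y i → ∞-block ≢ image (relabel i) C
  ∞-block≢relabel-block i p∈C p∉y eq with relabel-∉y i p∉y
  ... | x , _ , relabel-p≡old-x with ∈-image⁻ ∞ {⊤} (subst (_ ∈_) (sym eq) (∈-image⁺ (relabel i) p∈C))
  ...   | e , _ , ∞-e≡ = old≢∞ x e (trans (sym relabel-p≡old-x) (sym ∞-e≡))

  relabel∈old-block : ∀ i {A} p → relabel i p ∈ image old A → ∃ λ a → a ∈ A × grp a ≡ i × old a ≡ relabel i p
  relabel∈old-block i p p∈ with ∈-image⁻ old p∈
  ... | a , a∈A , old-a≡ = a , a∈A , relabel≡old⇒grp i p (sym old-a≡) , old-a≡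

  old-block≢relabel-block : ∀ i {A C} → Transversal grp A → ∣ C ∣ ≡ 4 → image old A ≢ image (relabel i) C
  old-block≢relabel-block i {A} {C} A-transversal ∣C∣≡4 eq with two-members C ∣C∣≡4
  ... | p , q , p≢q , p∈C , q∈C with relabel∈old-block i p (in-A p∈C) | relabel∈old-block i q (in-A q∈C)
    where
    in-A : ∀ {p} → p ∈ C → relabel i p ∈ image old A
    in-A p∈C = subst (_ ∈_) (sym eq) (∈-image⁺ (relabel i) p∈C)
  ...   | a , a∈A , grp-a≡i , old-a≡ | b , b∈A , grp-b≡i , old-b≡ = p≢q (relabel-injective i (begin
    relabel i p  ≡⟨ old-a≡ ⟨
    old a        ≡⟨ cong old (A-transversal a∈A b∈A (trans grp-a≡i (sym grp-b≡i))) ⟩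
    old b        ≡⟨ old-b≡ ⟩
    relabel i q  ∎))

  relabel-block-index : ∀ {i j C C′ p} → p ∈ C → p ∉ y i → image (relabel i) C ≡ image (relabel j) C′ → i ≡ j
  relabel-block-index {i} {j} p∈C p∉y eq with relabel-∉y i p∉y
  ... | x , grp-x≡i , relabel-p≡old-x with ∈-image⁻ (relabel j) (subst (_ ∈_) eq (∈-image⁺ (relabel i) p∈C))
  ...   | q , _ , relabel-q≡ = trans (sym grp-x≡i) (relabel≡old⇒grp j q (trans relabel-q≡ relabel-p≡old-x))

  data Origin (P : Pred (Subset n) 0ℓ) (Q : ∀ i → Pred (Subset (g i + 4)) 0ℓ) : Pred (Subset (n + 4)) 0ℓ where
    infinite : Origin P Q ∞-block
    from-gdd : ∀ {A} → P A → Origin P Q (image old A)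
    from-design : ∀ i {C} → Q i C → C ≢ y i → Origin P Q (image (relabel i) C)

  Origin-map : ∀ {P P′ Q Q′ B} → (∀ {A} → P A → P′ A) → (∀ {i C} → Q i C → Q′ i C) →
    Origin P Q B → Origin P′ Q′ B
  Origin-map f h infinite = infinite
  Origin-map f h (from-gdd PA) = from-gdd (f PA)
  Origin-map f h (from-design i QC C≢y) = from-design i (h QC) C≢y

  ∈-build⁺ : ∀ {𝒜 ℬ B} → Origin (_∈ᴸ 𝒜) (λ i → _∈ᴸ ℬ i) B → B ∈ᴸ build 𝒜 ℬ
  ∈-build⁺ {𝒜} infinite = ∈-++⁺ʳ (map (image old) 𝒜) (∈-++⁺ʳ _ (Any.here refl))
  ∈-build⁺ (from-gdd A∈𝒜) = ∈-++⁺ˡ (∈-map⁺ (image old) A∈𝒜)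
  ∈-build⁺ {𝒜} {ℬ} (from-design i C∈ℬ C≢y) = ∈-++⁺ʳ (map (image old) 𝒜) (∈-++⁺ˡ
    (∈-concat⁺′ (∈-map⁺ (image (relabel i)) (∈-filter⁺ _ C∈ℬ C≢y))
                (∈ᴸ-tabulate⁺ {f = λ i → relabelled i (ℬ i)} i)))

  ∈-build⁻ : ∀ {𝒜 ℬ B} → B ∈ᴸ build 𝒜 ℬ → Origin (_∈ᴸ 𝒜) (λ i → _∈ᴸ ℬ i) B
  ∈-build⁻ {𝒜} {ℬ} B∈ with ∈-++⁻ (map (image old) 𝒜) B∈
  ... | inj₁ B∈old with ∈-map⁻ (image old) B∈old
  ...   | A , A∈𝒜 , refl = from-gdd A∈𝒜
  ∈-build⁻ {𝒜} {ℬ} B∈ | inj₂ B∈tail with ∈-++⁻ (concat (List.tabulate λ i → relabelled i (ℬ i))) B∈tail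
  ...   | inj₂ (Any.here refl) = infinite
  ...   | inj₁ B∈relabelled with ∈-concat⁻′ (List.tabulate λ i → relabelled i (ℬ i)) B∈relabelled
  ...     | _ , B∈ , ∈tab with ∈ᴸ-tabulate⁻ ∈tab
  ...       | i , refl with ∈-map⁻ (image (relabel i)) B∈
  ...         | C , C∈without-y , refl with ∈-filter⁻ _ {xs = ℬ i} C∈without-y
  ...           | C∈ℬ , C≢y = from-design i C∈ℬ C≢y

  record Ingredients (𝒜 : Blocks n) (ℬ : ∀ i → Blocks (g i + 4)) : Set where
    field
      gdd : IsGDD4 grp 𝒜
      design : ∀ i → IsS24 (g i + 4) (ℬ i)
      y∈ : ∀ i → y i ∈ᴸ ℬ i

    transversal : ∀ {A} → A ∈ᴸ 𝒜 → Transversal grp A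
    transversal A∈𝒜 x∈A y∈A = IsGDD4.transverse gdd _ A∈𝒜 _ _ x∈A y∈A

    copies : ∀ i → Blocks (g i + 4)
    copies i = filter (_≟ˢ y i) (ℬ i)

    pairCount-split : ∀ i p q → pairCount p q (ℬ i) ≡ pairCount p q (copies i) + pairCount p q (without-y i (ℬ i))
    pairCount-split i p q = length-filter-split _ (_≟ˢ y i) (ℬ i)

    pair-in-y : ∀ i {p q} → p ≢ q → p ∈ y i → q ∈ y i →
      length (copies i) ≡ 1 × pairCount p q (without-y i (ℬ i)) ≡ 0
    pair-in-y i {p} {q} p≢q p∈y q∈y = split (length (copies i)) (pairCount p q (without-y i (ℬ i)))
      (trans (cong (_+ pairCount p q (without-y i (ℬ i))) (sym in-copies))
        (trans (sym (pairCount-split i p q)) (IsS24.pairOnce (design i) p q p≢q)))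
      (1≤length-filter (_≟ˢ y i) (y∈ i) refl)
      where
      in-copies : pairCount p q (copies i) ≡ length (copies i)
      in-copies = length-filter-all _ (copies i) λ C∈ → let (_ , C≡y) = ∈-filter⁻ _ {xs = ℬ i} C∈ in
        subst (λ C → p ∈ C × q ∈ C) (sym C≡y) (p∈y , q∈y)
      split : ∀ a b → a + b ≡ 1 → 1 ≤ a → a ≡ 1 × b ≡ 0
      split (suc a) b eq _ = cong suc (m+n≡0⇒m≡0 a (cong pred eq)) , m+n≡0⇒n≡0 a (cong pred eq)

    pair-not-in-y : ∀ i {p q} → p ≢ q → ¬ (p ∈ y i × q ∈ y i) → pairCount p q (without-y i (ℬ i)) ≡ 1
    pair-not-in-y i {p} {q} p≢q not-both = trans (cong (_+ pairCount p q (without-y i (ℬ i))) (sym no-copy))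
      (trans (sym (pairCount-split i p q)) (IsS24.pairOnce (design i) p q p≢q))
      where
      no-copy : pairCount p q (copies i) ≡ 0
      no-copy = length-filter-none _ (copies i) λ C∈ → let (_ , C≡y) = ∈-filter⁻ _ {xs = ℬ i} C∈ in
        not-both ∘ subst (λ C → p ∈ C × q ∈ C) C≡y

    copies-of-y : ∀ i → length (copies i) ≡ 1
    copies-of-y i with two-members (y i) (∣y∣≡4 i)
    ... | p , q , p≢q , p∈y , q∈y = proj₁ (pair-in-y i p≢q p∈y q∈y)

    ∣C∣≡4 : ∀ i {C} → C ∈ᴸ ℬ i → ∣ C ∣ ≡ 4
    ∣C∣≡4 i = IsS24.blockSize (design i) _

    outside-point : ∀ i {C} → C ∈ᴸ ℬ i → C ≢ y i → ∃ λ p → p ∈ C × p ∉ y i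
    outside-point i {C} C∈ℬ C≢y with two-members C (∣C∣≡4 i C∈ℬ)
    ... | p , q , p≢q , p∈C , q∈C with p ∈? y i | q ∈? y i
    ...   | no p∉y | _ = p , p∈C , p∉y
    ...   | yes _ | no q∉y = q , q∈C , q∉y
    ...   | yes p∈y | yes q∈y = contradiction (subst (1 ≤_) (proj₂ (pair-in-y i p≢q p∈y q∈y)) pair-in-C) λ ()
      where
      pair-in-C : 1 ≤ pairCount p q (without-y i (ℬ i))
      pair-in-C = 1≤length-filter _ (∈-filter⁺ _ C∈ℬ C≢y) (p∈C , q∈C)

  module _ {𝒜 ℬ} (ing : Ingredients 𝒜 ℬ) where
    open Ingredients ing

    relabelled-pairCount : ∀ i p q {u v} → relabel i p ≡ u → relabel i q ≡ v →
      pairCount u v (relabelled i (ℬ i)) ≡ pairCount p q (without-y i (ℬ i))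
    relabelled-pairCount i p q relabel-p relabel-q =
      pairCount-image (relabel-injective i) relabel-p relabel-q (without-y i (ℬ i))

    relabel-preimages-≢ : ∀ i p q {u v} → relabel i p ≡ u → relabel i q ≡ v → u ≢ v → p ≢ q
    relabel-preimages-≢ i p q relabel-p relabel-q u≢v refl = u≢v (trans (sym relabel-p) relabel-q)

    pairCount-∞-∞ : ∀ {e e′} → e ≢ e′ → pairCount (∞ e) (∞ e′) (build 𝒜 ℬ) ≡ 1
    pairCount-∞-∞ {e} {e′} e≢e′ = trans (pairCount-build _ _ 𝒜 ℬ)
      (cong₂ _+_ (pairCount-image-∉ˡ (λ x → old≢∞ x e) (∞ e′) 𝒜)
                 (cong₂ _+_ (sum-tabulate-≡0 no-design-block) ∞-block-once))
      where
      no-design-block : ∀ i → pairCount (∞ e) (∞ e′) (relabelled i (ℬ i)) ≡ 0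
      no-design-block i with relabel-onto-∞ i e | relabel-onto-∞ i e′
      ... | p , p∈y , relabel-p | q , q∈y , relabel-q = trans (relabelled-pairCount i p q relabel-p relabel-q)
        (proj₂ (pair-in-y i (relabel-preimages-≢ i p q relabel-p relabel-q (e≢e′ ∘ ∞-injective)) p∈y q∈y))
      ∞-block-once : pairCount (∞ e) (∞ e′) (∞-block ∷ []) ≡ 1
      ∞-block-once = trans (pairCount-image ∞-injective refl refl (⊤ ∷ [])) (pairCount-⊤ e e′)

    pairCount-∞-old : ∀ e x → pairCount (∞ e) (old x) (build 𝒜 ℬ) ≡ 1
    pairCount-∞-old e x = trans (pairCount-build _ _ 𝒜 ℬ)
      (cong₂ _+_ (pairCount-image-∉ˡ (λ x′ → old≢∞ x′ e) (old x) 𝒜)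
        (cong₂ _+_ (trans (sum-tabulate-single (grp x) other-design-block) own-design-block)
          (pairCount-image-∉ʳ (λ e′ eq → old≢∞ x e′ (sym eq)) (∞ e) (⊤ ∷ []))))
      where
      other-design-block : ∀ i → i ≢ grp x → pairCount (∞ e) (old x) (relabelled i (ℬ i)) ≡ 0
      other-design-block i i≢ =
        pairCount-image-∉ʳ (λ p eq → i≢ (sym (relabel≡old⇒grp i p eq))) (∞ e) (without-y i (ℬ i))
      own-design-block : pairCount (∞ e) (old x) (relabelled (grp x) (ℬ (grp x))) ≡ 1
      own-design-block with relabel-onto-∞ (grp x) e | relabel-onto-fibre (grp x) refl
      ... | p , _ , relabel-p | q , q∉y , relabel-q = trans (relabelled-pairCount (grp x) p q relabel-p relabel-q)
        (pair-not-in-y (grp x) (relabel-preimages-≢ (grp x) p q relabel-p relabel-q (old≢∞ x e ∘ sym))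
                               (q∉y ∘ proj₂))

    pairCount-old-old : ∀ {x x′} → x ≢ x′ → pairCount (old x) (old x′) (build 𝒜 ℬ) ≡ 1
    pairCount-old-old {x} {x′} x≢x′ = begin
      pairCount (old x) (old x′) (build 𝒜 ℬ)
        ≡⟨ pairCount-build _ _ 𝒜 ℬ ⟩
      pairCount (old x) (old x′) (map (image old) 𝒜) + (designs + pairCount (old x) (old x′) (∞-block ∷ []))
        ≡⟨ cong₂ (λ a b → a + (designs + b)) (pairCount-image old-injective refl refl 𝒜)
                 (pairCount-image-∉ˡ (λ e eq → old≢∞ x e (sym eq)) (old x′) (⊤ ∷ [])) ⟩
      pairCount x x′ 𝒜 + (designs + 0)
        ≡⟨ cong (pairCount x x′ 𝒜 +_) (+-identityʳ designs) ⟩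
      pairCount x x′ 𝒜 + designs
        ≡⟨ by-groups (grp x ≟ᶠ grp x′) ⟩
      1 ∎
      where
      designs : ℕ
      designs = sum (tabulate λ i → pairCount (old x) (old x′) (relabelled i (ℬ i)))
      not-own-block : ∀ {i} → grp x ≢ i → pairCount (old x) (old x′) (relabelled i (ℬ i)) ≡ 0
      not-own-block {i} x∉ =
        pairCount-image-∉ˡ (λ p eq → x∉ (relabel≡old⇒grp i p eq)) (old x′) (without-y i (ℬ i))
      by-groups : Dec (grp x ≡ grp x′) → pairCount x x′ 𝒜 + designs ≡ 1
      by-groups (yes same) with relabel-onto-fibre (grp x) refl | relabel-onto-fibre (grp x) (sym same)
      ... | p , p∉y , relabel-p | q , _ , relabel-q = cong₂ _+_
        (length-filter-none _ 𝒜 λ A∈ (x∈A , x′∈A) → x≢x′ (transversal A∈ x∈A x′∈A same))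
        (trans (sum-tabulate-single (grp x) λ i i≢ → not-own-block (i≢ ∘ sym))
          (trans (relabelled-pairCount (grp x) p q relabel-p relabel-q)
            (pair-not-in-y (grp x) (relabel-preimages-≢ (grp x) p q relabel-p relabel-q (x≢x′ ∘ old-injective))
                                   (p∉y ∘ proj₁))))
      by-groups (no different) = cong₂ _+_ (IsGDD4.pairOnce gdd x x′ different)
        (sum-tabulate-≡0 not-own-design-block)
        where
        not-own-design-block : ∀ i → pairCount (old x) (old x′) (relabelled i (ℬ i)) ≡ 0
        not-own-design-block i with grp x ≟ᶠ i
        ... | no x∉ = not-own-block x∉
        ... | yes refl = pairCount-image-∉ʳ (λ p eq → different (sym (relabel≡old⇒grp (grp x) p eq)))
                                            (old x) (without-y (grp x) (ℬ (grp x)))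

    build-isS24 : IsS24 (n + 4) (build 𝒜 ℬ)
    build-isS24 = record { blockSize = blockSize ; pairOnce = pairOnce }
      where
      blockSize : ∀ B → B ∈ᴸ build 𝒜 ℬ → ∣ B ∣ ≡ 4
      blockSize B B∈ with ∈-build⁻ B∈
      ... | infinite = trans (∣image∣ ∞-injective ⊤) (∣⊤∣≡n 4)
      ... | from-gdd A∈𝒜 = trans (∣image∣ old-injective _) (IsGDD4.blockSize gdd _ A∈𝒜)
      ... | from-design i C∈ℬ _ = trans (∣image∣ (relabel-injective i) _) (∣C∣≡4 i C∈ℬ)
      pairOnce : ∀ u v → u ≢ v → pairCount u v (build 𝒜 ℬ) ≡ 1
      pairOnce u v u≢v with old-or-∞ u | old-or-∞ v
      ... | inj₂ (e , refl) | inj₂ (e′ , refl) = pairCount-∞-∞ (u≢v ∘ cong ∞)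
      ... | inj₂ (e , refl) | inj₁ (x , refl) = pairCount-∞-old e x
      ... | inj₁ (x , refl) | inj₂ (e , refl) = trans (pairCount-sym (build 𝒜 ℬ)) (pairCount-∞-old e x)
      ... | inj₁ (x , refl) | inj₁ (x′ , refl) = pairCount-old-old (u≢v ∘ cong old)

    old-block∈build⁻ : ∀ {A} → Transversal grp A → image old A ∈ᴸ build 𝒜 ℬ → A ∈ᴸ 𝒜
    old-block∈build⁻ {A} A-transversal A∈ = from-origin (∈-build⁻ A∈) refl
      where
      from-origin : ∀ {B} → Origin (_∈ᴸ 𝒜) (λ i → _∈ᴸ ℬ i) B → B ≡ image old A → A ∈ᴸ 𝒜
      from-origin infinite eq = contradiction eq (∞-block≢old-block A)
      from-origin (from-gdd A′∈𝒜) eq = subst (_∈ᴸ 𝒜) (image-injective old-injective eq) A′∈𝒜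
      from-origin (from-design i C∈ℬ _) eq =
        contradiction (sym eq) (old-block≢relabel-block i A-transversal (∣C∣≡4 i C∈ℬ))

    relabel-block∈build⁻ : ∀ i {C p} → p ∈ C → p ∉ y i → ∣ C ∣ ≡ 4 →
      image (relabel i) C ∈ᴸ build 𝒜 ℬ → C ∈ᴸ ℬ i
    relabel-block∈build⁻ i {C} p∈C p∉y ∣C∣≡4 C∈ = from-origin (∈-build⁻ C∈) refl
      where
      same-design : ∀ {j C′} → i ≡ j → image (relabel j) C′ ≡ image (relabel i) C → C′ ∈ᴸ ℬ j → C ∈ᴸ ℬ i
      same-design refl eq C′∈ℬ = subst (_∈ᴸ ℬ i) (image-injective (relabel-injective i) eq) C′∈ℬ
      from-origin : ∀ {B} → Origin (_∈ᴸ 𝒜) (λ i → _∈ᴸ ℬ i) B → B ≡ image (relabel i) C → C ∈ᴸ ℬ i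
      from-origin infinite eq = contradiction eq (∞-block≢relabel-block i p∈C p∉y)
      from-origin (from-gdd A∈𝒜) eq = contradiction eq (old-block≢relabel-block i (transversal A∈𝒜) ∣C∣≡4)
      from-origin (from-design j C′∈ℬ _) eq = same-design (relabel-block-index p∈C p∉y (sym eq)) eq C′∈ℬ

  origin⇒common : ∀ {𝒜 𝒜′ ℬ ℬ′ B} → Origin (Common 𝒜 𝒜′) (λ i → Common (ℬ i) (ℬ′ i)) B →
    Common (build 𝒜 ℬ) (build 𝒜′ ℬ′) B
  origin⇒common {𝒜} {𝒜′} {ℬ} {ℬ′} o =
    ∈-build⁺ {𝒜} {ℬ} (Origin-map proj₁ proj₁ o) , ∈-build⁺ {𝒜′} {ℬ′} (Origin-map proj₂ proj₂ o)

  module _ {𝒜 𝒜′ ℬ ℬ′} (ing : Ingredients 𝒜 ℬ) (ing′ : Ingredients 𝒜′ ℬ′) where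
    open Ingredients ing

    common⇒origin : ∀ {B} → Common (build 𝒜 ℬ) (build 𝒜′ ℬ′) B →
      Origin (Common 𝒜 𝒜′) (λ i → Common (ℬ i) (ℬ′ i)) B
    common⇒origin (B∈ , B∈′) with ∈-build⁻ B∈
    ... | infinite = infinite
    ... | from-gdd A∈𝒜 = from-gdd (A∈𝒜 , old-block∈build⁻ ing′ (transversal A∈𝒜) B∈′)
    ... | from-design i C∈ℬ C≢y with outside-point i C∈ℬ C≢y
    ...   | p , p∈C , p∉y =
      from-design i (C∈ℬ , relabel-block∈build⁻ ing′ i p∈C p∉y (∣C∣≡4 i C∈ℬ) B∈′) C≢y

    count-common : length (filter (_∈ᴮ? build 𝒜′ ℬ′) (build 𝒜 ℬ)) ≡
      length (filter (_∈ᴮ? 𝒜′) 𝒜) + (sum (tabulate λ i → length (filter (_∈ᴮ? ℬ′ i) (without-y i (ℬ i)))) + 1)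
    count-common = trans (length-filter-++ P? (map (image old) 𝒜) _)
      (cong₂ _+_ old-part (trans (length-filter-++ P? (concat (List.tabulate λ i → relabelled i (ℬ i))) _)
        (cong₂ _+_ (trans (length-filter-concat P? λ i → relabelled i (ℬ i)) (cong sum (tabulate-cong design-part)))
          ∞-part)))
      where
      P? : Decidable (_∈ᴸ build 𝒜′ ℬ′)
      P? = _∈ᴮ? build 𝒜′ ℬ′
      old-part : length (filter P? (map (image old) 𝒜)) ≡ length (filter (_∈ᴮ? 𝒜′) 𝒜)
      old-part = length-filter-map P? (_∈ᴮ? 𝒜′) (image old) 𝒜
        (λ A∈ → old-block∈build⁻ ing′ (transversal A∈)) (λ _ A∈′ → ∈-build⁺ {𝒜′} {ℬ′} (from-gdd A∈′))
      design-part : ∀ i → length (filter P? (relabelled i (ℬ i))) ≡ length (filter (_∈ᴮ? ℬ′ i) (without-y i (ℬ i)))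
      design-part i = length-filter-map P? (_∈ᴮ? ℬ′ i) (image (relabel i)) (without-y i (ℬ i)) in-ℬ′ in-build′
        where
        in-ℬ′ : ∀ {C} → C ∈ᴸ without-y i (ℬ i) → image (relabel i) C ∈ᴸ build 𝒜′ ℬ′ → C ∈ᴸ ℬ′ i
        in-ℬ′ C∈ with ∈-filter⁻ _ {xs = ℬ i} C∈
        ... | C∈ℬ , C≢y with outside-point i C∈ℬ C≢y
        ...   | p , p∈C , p∉y = relabel-block∈build⁻ ing′ i p∈C p∉y (∣C∣≡4 i C∈ℬ)
        in-build′ : ∀ {C} → C ∈ᴸ without-y i (ℬ i) → C ∈ᴸ ℬ′ i → image (relabel i) C ∈ᴸ build 𝒜′ ℬ′
        in-build′ C∈ C∈′ = ∈-build⁺ {𝒜′} {ℬ′} (from-design i C∈′ (proj₂ (∈-filter⁻ _ {xs = ℬ i} C∈)))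
      ∞-part : length (filter P? (∞-block ∷ [])) ≡ 1
      ∞-part = length-filter-all P? (∞-block ∷ []) λ { (Any.here refl) → ∈-build⁺ {𝒜′} {ℬ′} infinite }

    count-common-design : ∀ i →
      length (filter (_∈ᴮ? ℬ′ i) (ℬ i)) ≡ suc (length (filter (_∈ᴮ? ℬ′ i) (without-y i (ℬ i))))
    count-common-design i = trans (length-filter-split _ (_≟ˢ y i) (ℬ i))
      (cong (_+ length (filter (_∈ᴮ? ℬ′ i) (without-y i (ℬ i)))) (trans copies-common (copies-of-y i)))
      where
      copies-common : length (filter (_∈ᴮ? ℬ′ i) (copies i)) ≡ length (copies i)
      copies-common = length-filter-all _ (copies i) λ C∈ →
        subst (_∈ᴸ ℬ′ i) (sym (proj₂ (∈-filter⁻ _ {xs = ℬ i} C∈))) (Ingredients.y∈ ing′ i)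

  lift-common : ∀ {𝒜₁ 𝒜₂ 𝒜₃ 𝒜₄ ℬ₁ ℬ₂ ℬ₃ ℬ₄} → Ingredients 𝒜₁ ℬ₁ → Ingredients 𝒜₂ ℬ₂ →
    (∀ {A} → Common 𝒜₁ 𝒜₂ A → Common 𝒜₃ 𝒜₄ A) → (∀ {i C} → Common (ℬ₁ i) (ℬ₂ i) C → Common (ℬ₃ i) (ℬ₄ i) C) →
    ∀ {B} → Common (build 𝒜₁ ℬ₁) (build 𝒜₂ ℬ₂) B → Common (build 𝒜₃ ℬ₃) (build 𝒜₄ ℬ₄) B
  lift-common ing₁ ing₂ f h = origin⇒common ∘ Origin-map f h ∘ common⇒origin ing₁ ing₂

  three-designs : ∀ {𝒜₁ 𝒜₂ 𝒜₃ ℬ₁ ℬ₂ ℬ₃ b bs} →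
    Ingredients 𝒜₁ ℬ₁ → Ingredients 𝒜₂ ℬ₂ → Ingredients 𝒜₃ ℬ₃ →
    ExactlyCommon 𝒜₁ 𝒜₂ 𝒜₃ b → (∀ i → ExactlyCommon (ℬ₁ i) (ℬ₂ i) (ℬ₃ i) (bs i)) →
    ThreeDesigns (n + 4) λ c → c + s ≡ b + sum (tabulate bs) + 1
  three-designs {𝒜₁} {𝒜₂} {𝒜₃} {ℬ₁} {ℬ₂} {ℬ₃} {b} {bs} ing₁ ing₂ ing₃
                (𝒜₁₂⇔𝒜₁₃ , 𝒜₁₂⇔𝒜₂₃ , ∣𝒜₁₂∣≡b) ℬ-common =
    build 𝒜₁ ℬ₁ , build 𝒜₂ ℬ₂ , build 𝒜₃ ℬ₃ , _ ,
    build-isS24 ing₁ , build-isS24 ing₂ , build-isS24 ing₃ ,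
    ((λ _ → mk⇔ (lift-common ing₁ ing₂ (to (𝒜₁₂⇔𝒜₁₃ _)) (to (ℬ₁₂⇔ℬ₁₃ _ _)))
               (lift-common ing₁ ing₃ (from (𝒜₁₂⇔𝒜₁₃ _)) (from (ℬ₁₂⇔ℬ₁₃ _ _)))) ,
    (λ _ → mk⇔ (lift-common ing₁ ing₂ (to (𝒜₁₂⇔𝒜₂₃ _)) (to (ℬ₁₂⇔ℬ₂₃ _ _)))
               (lift-common ing₂ ing₃ (from (𝒜₁₂⇔𝒜₂₃ _)) (from (ℬ₁₂⇔ℬ₂₃ _ _)))) ,
    refl) ,
    (begin
      length (filter (_∈ᴮ? build 𝒜₂ ℬ₂) (build 𝒜₁ ℬ₁)) + s  ≡⟨ cong (_+ s) (count-common ing₁ ing₂) ⟩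
      ∣𝒜₁₂∣ + (sum (tabulate h) + 1) + s                     ≡⟨ cong (λ a → a + (sum (tabulate h) + 1) + s) ∣𝒜₁₂∣≡b ⟩
      b + (sum (tabulate h) + 1) + s                         ≡⟨ rearrange b (sum (tabulate h)) s ⟩
      b + (sum (tabulate h) + s) + 1                         ≡⟨ cong (λ a → b + a + 1) (sum-tabulate-suc h) ⟨
      b + sum (tabulate (suc ∘ h)) + 1                       ≡⟨ cong (λ a → b + sum a + 1) (tabulate-cong ∣ℬ₁₂∣≡suc-h) ⟩
      b + sum (tabulate bs) + 1                              ∎)
    where
    open Equivalence
    rearrange : ∀ a b c → a + (b + 1) + c ≡ a + (b + c) + 1
    rearrange = solve-∀
    ℬ₁₂⇔ℬ₁₃ : ∀ i C → Common (ℬ₁ i) (ℬ₂ i) C ⇔ Common (ℬ₁ i) (ℬ₃ i) C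
    ℬ₁₂⇔ℬ₁₃ i = proj₁ (ℬ-common i)
    ℬ₁₂⇔ℬ₂₃ : ∀ i C → Common (ℬ₁ i) (ℬ₂ i) C ⇔ Common (ℬ₂ i) (ℬ₃ i) C
    ℬ₁₂⇔ℬ₂₃ i = proj₁ (proj₂ (ℬ-common i))
    ∣𝒜₁₂∣ : ℕ
    ∣𝒜₁₂∣ = length (filter (_∈ᴮ? 𝒜₂) 𝒜₁)
    h : Fin s → ℕ
    h i = length (filter (_∈ᴮ? ℬ₂ i) (without-y i (ℬ₁ i)))
    ∣ℬ₁₂∣≡suc-h : ∀ i → suc (h i) ≡ bs i
    ∣ℬ₁₂∣≡suc-h i = trans (sym (count-common-design ing₁ ing₂ i)) (proj₂ (proj₂ (ℬ-common i)))

theorem3p3 : (s : ℕ) (g : Fin s → ℕ) (b : ℕ) (bs : Fin s → ℕ) →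
    (Σ ℕ λ n → Σ (Fin n → Fin s) λ grp → HasType grp g ×
      (Σ (Blocks n) λ 𝒜₁ → Σ (Blocks n) λ 𝒜₂ → Σ (Blocks n) λ 𝒜₃ →
        IsGDD4 grp 𝒜₁ × IsGDD4 grp 𝒜₂ × IsGDD4 grp 𝒜₃ × ExactlyCommon 𝒜₁ 𝒜₂ 𝒜₃ b)) →
    ((i : Fin s) → Σ (Blocks (g i + 4)) λ ℬ₁ → Σ (Blocks (g i + 4)) λ ℬ₂ → Σ (Blocks (g i + 4)) λ ℬ₃ →
        IsS24 (g i + 4) ℬ₁ × IsS24 (g i + 4) ℬ₂ × IsS24 (g i + 4) ℬ₃ × ExactlyCommon ℬ₁ ℬ₂ ℬ₃ (bs i) ×
        (∃ λ y → y ∈ᴸ ℬ₁ × y ∈ᴸ ℬ₂ × y ∈ᴸ ℬ₃)) →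
    Σ (Blocks (sum (tabulate g) + 4)) λ ℬ₁ → Σ (Blocks (sum (tabulate g) + 4)) λ ℬ₂ →
      Σ (Blocks (sum (tabulate g) + 4)) λ ℬ₃ → Σ ℕ λ c →
        IsS24 (sum (tabulate g) + 4) ℬ₁ × IsS24 (sum (tabulate g) + 4) ℬ₂ × IsS24 (sum (tabulate g) + 4) ℬ₃ ×
        ExactlyCommon ℬ₁ ℬ₂ ℬ₃ c × (c + s ≡ b + sum (tabulate bs) + 1)
theorem3p3 s g b bs (n , grp , type , 𝒜₁ , 𝒜₂ , 𝒜₃ , gdd₁ , gdd₂ , gdd₃ , 𝒜-common) designs =
  subst (λ m → ThreeDesigns (m + 4) λ c → c + s ≡ b + sum (tabulate bs) + 1) (sym (number-of-points grp type))
    (three-designs ing₁ ing₂ ing₃ 𝒜-common λ i →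
      let (_ , _ , _ , _ , _ , _ , ℬ-common , _) = designs i in ℬ-common)
  where
  y : ∀ i → Subset (g i + 4)
  y i = let (_ , _ , _ , _ , _ , _ , _ , C , _) = designs i in C
  ∣y∣≡4 : ∀ i → ∣ y i ∣ ≡ 4
  ∣y∣≡4 i = let (_ , _ , _ , D₁ , _ , _ , _ , _ , y∈ℬ₁ , _) = designs i in IsS24.blockSize D₁ _ y∈ℬ₁
  open Construction g grp type y ∣y∣≡4
  ing₁ : Ingredients 𝒜₁ λ i → proj₁ (designs i)
  ing₁ = record { gdd = gdd₁ ; design = λ i → let (_ , _ , _ , D₁ , _) = designs i in D₁
                ; y∈ = λ i → let (_ , _ , _ , _ , _ , _ , _ , _ , y∈ℬ₁ , _) = designs i in y∈ℬ₁ }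
  ing₂ : Ingredients 𝒜₂ λ i → proj₁ (proj₂ (designs i))
  ing₂ = record { gdd = gdd₂ ; design = λ i → let (_ , _ , _ , _ , D₂ , _) = designs i in D₂
                ; y∈ = λ i → let (_ , _ , _ , _ , _ , _ , _ , _ , _ , y∈ℬ₂ , _) = designs i in y∈ℬ₂ }
  ing₃ : Ingredients 𝒜₃ λ i → proj₁ (proj₂ (proj₂ (designs i)))
  ing₃ = record { gdd = gdd₃ ; design = λ i → let (_ , _ , _ , _ , _ , D₃ , _) = designs i in D₃
                ; y∈ = λ i → let (_ , _ , _ , _ , _ , _ , _ , _ , _ , _ , y∈ℬ₃) = designs i in y∈ℬ₃ }
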